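{- Let $\Sigma$ be a signature. The endofunctor $\int$ on $Lax_{Inj}(\mathcal{L}_\Sigma^{op},Poset)$ canonically supports the structure of a monad, with unit $\eta_H:H\Rightarrow\int\! H$ given at $n$ by the colimit injection $\rho_{\mathrm{id}_n}:Hn\to\int\! H(n)$, and with multiplication $\mu_H:\int\!\int\! H\Rightarrow\int\! H$ given at $n$ as follows: $\int\!\int\! H(n)$ is a colimit, indexed by canonical injections $n\to n+k$, of the colimits $\int\! H(n+k)$, indexed by canonical injections $n+k\to n+k+l$, of $H(n+k+l)$; $(\mu_H)_n$ is the map induced by this doubly indexed colimit from the maps $\rho_{j_{k+l}}:H(n+k+l)\to\int\! H(n)$, where $j_{k+l}:n\to n+(k+l)$ is the canonical injection.
   Context: $\Sigma$ is a set of function symbols with arities. $\mathcal{L}_\Sigma$: objects natural numbers; with fixed variables $x_1,\ldots,x_n$, $\mathcal{L}_\Sigma(n,m)$ is the set of $m$-tuples of terms over $\Sigma$ in $x_1,\ldots,x_n$; composition is substitution. $Inj$ is the category of natural numbers and injections, with canonical identity-on-objects functor $J:Inj^{op}\to\mathcal{L}_\Sigma$ (injection $i:n\to m$ goes to the tuple $(x_{i(1)},\ldots,x_{i(n)}):m\to n$). Every object $j:n\to m$ of $n/Inj$ is isomorphic to a canonical inclusion $n\to n+k$ for a unique $k$. A lax transformation $\alpha:H\to K$ between functors $\mathcal{L}_\Sigma^{op}\to Poset$ is a family of order-preserving maps $\alpha_n:Hn\to Kn$ with $(Kf)\circ\alpha_m\le\alpha_n\circ(Hf)$ for all $f:n\to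 m$ in $\mathcal{L}_\Sigma$. $Lax_{Inj}(\mathcal{L}_\Sigma^{op},Poset)$: objects functors $\mathcal{L}_\Sigma^{op}\to Poset$, maps lax transformations with $K(Ji)\circ\alpha_n=\alpha_m\circ H(Ji)$ for all injections $i:n\to m$, pointwise composition. The endofunctor $\int$: $\int\! H(n)$ is the colimit in $Poset$ of $n/Inj\xrightarrow{cod}Inj\xrightarrow{J^{op}}\mathcal{L}_\Sigma^{op}\xrightarrow{H}Poset$, with colimit injections $\rho_j:H(m)\to\int\! H(n)$ ($j:n\to m$); for $f:n\to n'$ in $\mathcal{L}_\Sigma$, $\int\! H(f):\int\! H(n')\to\int\! H(n)$ is induced by the maps $\rho_j\circ H(f+k):H(n'+k)\to\int\! H(n)$, where $j:n\to n+k$ is canonical and $f+k=(f_1,\ldots,f_{n'},x_{n+1},\ldots,x_{n+k}):n+k\to n'+k$; for a map $\alpha$, $(\int\!\alpha)_n$ is induced by the maps $\rho_j\circ\alpha_{n+k}$. -}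

module Defs where

open import Level using (0ℓ)
open import Data.Nat using (ℕ; zero; suc; _+_)
open import Data.Nat.Properties using (+-assoc)
open import Data.Fin using (Fin; _↑ˡ_; _↑ʳ_; cast)
open import Data.Vec using (Vec; []; _∷_; lookup; tabulate; _++_)
open import Data.Product using (Σ; _,_; _×_; proj₁; proj₂; swap)
open import Function using (_∘_; _↣_; Injection)
open import Relation.Binary.Bundles using (Poset)
open import Relation.Binary.PropositionalEquality using (_≡_)

record Signature : Set₁ where
  field
    Op    : Set
    arity : Op → ℕ

open Signature public

module _ (Sg : Signature) where

  data Term (n : ℕ) : Set where
    var : Fin n → Term n
    op  : (o : Op Sg) → Vec (Term n) (arity Sg o) → Term n

  -- L_Σ(n , m) : m-tuples of terms in n variables
  Hom : ℕ → ℕ → Set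
  Hom n m = Vec (Term n) m

  mutual
    sub : ∀ {m n} → Term m → Hom n m → Term n
    sub (var i)   σ = lookup σ i
    sub (op o ts) σ = op o (subs ts σ)

    subs : ∀ {m n k} → Vec (Term m) k → Hom n m → Vec (Term n) k
    subs []       σ = []
    subs (t ∷ ts) σ = sub t σ ∷ subs ts σ

  idL : ∀ n → Hom n n
  idL n = tabulate var

  _∘L_ : ∀ {n m p} → Hom m p → Hom n m → Hom n p
  g ∘L f = subs g f

  Jfun : ∀ {n m} → (Fin n → Fin m) → Hom m n
  Jfun i = tabulate (λ a → var (i a))

  J : ∀ {n m} → Fin n ↣ Fin m → Hom m n
  J i = Jfun (Injection.to i)

  ι : ∀ n k → Fin n → Fin (n + k)
  ι n k a = a ↑ˡ k

  -- f + k = (f_1 … f_{n'}, x_{n+1} … x_{n+k}) : n + k → n' + k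
  _+L_ : ∀ {n n'} → Hom n n' → (k : ℕ) → Hom (n + k) (n' + k)
  _+L_ {n} f k = (f ∘L Jfun (ι n k)) ++ tabulate (λ a → var (n ↑ʳ a))

  record Psh : Set₁ where
    field
      obj : ℕ → Poset 0ℓ 0ℓ 0ℓ
      act : ∀ {n m} → Hom n m → Poset.Carrier (obj m) → Poset.Carrier (obj n)

  open Psh public

  Car : Psh → ℕ → Set
  Car H n = Poset.Carrier (obj H n)

  _⊢_≤_ : (H : Psh) {n : ℕ} → Car H n → Car H n → Set
  H ⊢ x ≤ y = Poset._≤_ (obj H _) x y

  _⊢_≈_ : (H : Psh) {n : ℕ} → Car H n → Car H n → Set
  H ⊢ x ≈ y = Poset._≈_ (obj H _) x y

  record IsPsh (H : Psh) : Set where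
    field
      act-mono : ∀ {n m} (f : Hom n m) {x y : Car H m} →
                 H ⊢ x ≤ y → H ⊢ act H f x ≤ act H f y
      act-id   : ∀ {n} (x : Car H n) → H ⊢ act H (idL n) x ≈ x
      act-∘    : ∀ {n m p} (f : Hom n m) (g : Hom m p) (x : Car H p) →
                 H ⊢ act H (g ∘L f) x ≈ act H f (act H g x)

  Trans : Psh → Psh → Set
  Trans H K = ∀ n → Car H n → Car K n

  idT : ∀ H → Trans H H
  idT H n x = x

  _∘T_ : ∀ {H K M} → Trans K M → Trans H K → Trans H M
  (β ∘T α) n x = β n (α n x)

  _≈T_ : ∀ {H K} → Trans H K → Trans H K → Set
  _≈T_ {H} {K} α β = ∀ n (x : Car H n) → K ⊢ α n x ≈ β n x

  record IsLaxInj (H K : Psh) (α : Trans H K) : Set where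
    field
      mono   : ∀ n {x y : Car H n} → H ⊢ x ≤ y → K ⊢ α n x ≤ α n y
      lax    : ∀ {n m} (f : Hom n m) (x : Car H m) →
               K ⊢ act K f (α m x) ≤ α n (act H f x)
      strict : ∀ {n m} (i : Fin n ↣ Fin m) (x : Car H n) →
               K ⊢ act K (J i) (α n x) ≈ α m (act H (J i) x)

  -- ∫ H (n) : colimit in Poset of  n/Inj → Inj → L_Σ^op → Poset,
  -- computed over the skeleton of n/Inj given by the canonical
  -- injections n → n + k (the morphisms k → k' being the injections
  -- h : n + k → n + k' with h ∘ ι_k = ι_k').

  ∫Car : Psh → ℕ → Set
  ∫Car H n = Σ ℕ (λ k → Car H (n + k))

  Under : ∀ n k k' → Fin (n + k) ↣ Fin (n + k') → Set
  Under n k k' h = ∀ a → Injection.to h (ι n k a) ≡ ι n k' a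

  -- the order generated by the orders of the H(n+k) and the cocone
  -- identifications ρ_k = ρ_k' ∘ H(J h)
  data ∫≤ (H : Psh) (n : ℕ) : ∫Car H n → ∫Car H n → Set where
    base  : ∀ {k} {x y : Car H (n + k)} → H ⊢ x ≤ y → ∫≤ H n (k , x) (k , y)
    glue  : ∀ {k k'} (h : Fin (n + k) ↣ Fin (n + k')) → Under n k k' h →
            (x : Car H (n + k)) → ∫≤ H n (k , x) (k' , act H (J h) x)
    glue⁻ : ∀ {k k'} (h : Fin (n + k) ↣ Fin (n + k')) → Under n k k' h →
            (x : Car H (n + k)) → ∫≤ H n (k' , act H (J h) x) (k , x)
    trans : ∀ {a b c} → ∫≤ H n a b → ∫≤ H n b c → ∫≤ H n a c

  -- poset reflection: equality = mutual ≤
  ∫≈ : (H : Psh) (n : ℕ) → ∫Car H n → ∫Car H n → Set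
  ∫≈ H n a b = ∫≤ H n a b × ∫≤ H n b a

  ∫≤-refl : ∀ H n {a} → ∫≤ H n a a
  ∫≤-refl H n {k , x} = base (Poset.refl (obj H (n + k)))

  ∫Poset : Psh → ℕ → Poset 0ℓ 0ℓ 0ℓ
  ∫Poset H n = record
    { Carrier = ∫Car H n
    ; _≈_ = ∫≈ H n
    ; _≤_ = ∫≤ H n
    ; isPartialOrder = record
      { isPreorder = record
        { isEquivalence = record
          { refl  = ∫≤-refl H n , ∫≤-refl H n
          ; sym   = swap
          ; trans = λ p q → trans (proj₁ p) (proj₁ q) , trans (proj₂ q) (proj₂ p)
          }
        ; reflexive = proj₁
        ; trans = trans
        }
      ; antisym = _,_
      }
    }

  ∫ : Psh → Psh
  ∫ H = record
    { obj = ∫Poset H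
    ; act = λ {n} {n'} f → λ { (k , y) → k , act H (f +L k) y }
    }

  ∫₁ : ∀ {H K} → Trans H K → Trans (∫ H) (∫ K)
  ∫₁ α n (k , x) = k , α (n + k) x

  -- unit: η_H at n is the colimit injection ρ_{id_n}, i.e. ρ_{ι_0} ∘ H(J ι_0)
  -- (ι_0 : n → n + 0 is the morphism id_n → ι_0 in n/Inj)
  η : ∀ H → Trans H (∫ H)
  η H n x = 0 , act H (Jfun (ι n 0)) x

  -- multiplication: ρ_k(ρ_l x) ↦ ρ_{k+l} x, where H(n+k+l) is identified
  -- with H(n+(k+l)) along the canonical bijection
  μ : ∀ H → Trans (∫ (∫ H)) (∫ H)
  μ H n (k , (l , x)) = (k + l) , act H (Jfun (cast (+-assoc n k l))) x

  record IsMonad∫ : Set₁ where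
    field
      ∫-obj  : ∀ H → IsPsh H → IsPsh (∫ H)
      ∫-map  : ∀ H K (α : Trans H K) → IsPsh H → IsPsh K →
               IsLaxInj H K α → IsLaxInj (∫ H) (∫ K) (∫₁ {H} {K} α)
      ∫-id   : ∀ H → IsPsh H → _≈T_ {∫ H} {∫ H} (∫₁ {H} {H} (idT H)) (idT (∫ H))
      ∫-∘    : ∀ H K M (α : Trans H K) (β : Trans K M) →
               IsPsh H → IsPsh K → IsPsh M →
               IsLaxInj H K α → IsLaxInj K M β →
               _≈T_ {∫ H} {∫ M} (∫₁ {H} {M} (_∘T_ {H} {K} {M} β α))
                    (_∘T_ {∫ H} {∫ K} {∫ M} (∫₁ {K} {M} β) (∫₁ {H} {K} α))
      η-map  : ∀ H → IsPsh H → IsLaxInj H (∫ H) (η H)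
      μ-map  : ∀ H → IsPsh H → IsLaxInj (∫ (∫ H)) (∫ H) (μ H)
      η-nat  : ∀ H K (α : Trans H K) → IsPsh H → IsPsh K → IsLaxInj H K α →
               _≈T_ {H} {∫ K} (_∘T_ {H} {∫ H} {∫ K} (∫₁ {H} {K} α) (η H))
                              (_∘T_ {H} {K} {∫ K} (η K) α)
      μ-nat  : ∀ H K (α : Trans H K) → IsPsh H → IsPsh K → IsLaxInj H K α →
               _≈T_ {∫ (∫ H)} {∫ K}
                 (_∘T_ {∫ (∫ H)} {∫ H} {∫ K} (∫₁ {H} {K} α) (μ H))
                 (_∘T_ {∫ (∫ H)} {∫ (∫ K)} {∫ K} (μ K) (∫₁ {∫ H} {∫ K} (∫₁ {H} {K} α)))
      unit-l : ∀ H → IsPsh H →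
               _≈T_ {∫ H} {∫ H} (_∘T_ {∫ H} {∫ (∫ H)} {∫ H} (μ H) (η (∫ H))) (idT (∫ H))
      unit-r : ∀ H → IsPsh H →
               _≈T_ {∫ H} {∫ H} (_∘T_ {∫ H} {∫ (∫ H)} {∫ H} (μ H) (∫₁ {H} {∫ H} (η H))) (idT (∫ H))
      assoc  : ∀ H → IsPsh H →
               _≈T_ {∫ (∫ (∫ H))} {∫ H}
                 (_∘T_ {∫ (∫ (∫ H))} {∫ (∫ H)} {∫ H} (μ H) (μ (∫ H)))
                 (_∘T_ {∫ (∫ (∫ H))} {∫ (∫ H)} {∫ H} (μ H) (∫₁ {∫ (∫ H)} {∫ H} (μ H)))

-- ∫H(n) is presented by generators (k , x) with x ∈ H(n + k), ordered by the
-- orders of H and glued along injections under n.  Every structure map is given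
-- on generators, so each law reduces to two kinds of facts.  First, each map sends
-- a gluing along h to a gluing along an induced injection: id ⊕ (h restricted to the
-- fresh variables) for ∫H(f); h ⊕ id, or h itself, conjugated by reassociation for μ;
-- for ∫α this is strictness of α on injections.  Second, equations in L_Σ, which all
-- follow from naturality of f ↦ f + k in the fresh variables and its associativity
-- up to n + k + l ≅ n + (k + l).  In fact η and μ are strict, so laxness is free.

module Submission where

open import Defs
open import Data.Empty using (⊥-elim)
open import Data.Nat using (ℕ; _+_)
import Data.Nat as ℕ
open import Data.Nat.Properties using (+-assoc; +-identityʳ)
open import Data.Fin as Fin using (Fin; _↑ˡ_; _↑ʳ_; cast; toℕ; splitAt; join)
open import Data.Fin.Properties
  using (toℕ-injective; cast-involutive; toℕ-↑ˡ; toℕ-↑ʳ; toℕ-cast; splitAt-↑ˡ; splitAt-↑ʳ; ↑ˡ-injective; ↑ʳ-injective)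
open import Data.Vec using (Vec; []; _∷_; lookup)
open import Data.Vec.Properties using (lookup∘tabulate; tabulate∘lookup; tabulate-cong; lookup-++ˡ; lookup-++ʳ)
open import Data.Sum using () renaming (map to ⊎-map)
open import Data.Product using (Σ; _,_; proj₁; proj₂; swap)
open import Function using (_∘_; id; _↣_; Injection)
open import Function.Bundles using (mk↣)
open import Function.Definitions using (Injective)
open import Relation.Binary.Bundles using (Poset)
import Relation.Binary.Reasoning.Setoid as SetoidReasoning
import Relation.Binary.PropositionalEquality as ≡
open ≡ using (_≡_; _≢_; refl; sym; cong; cong₂; _≗_; module ≡-Reasoning)

private variable
  n m p q k k' l l' : ℕ

-- Finite ordinals

data Split (m n : ℕ) : Fin (m + n) → Set where
  left  : (a : Fin m) → Split m n (a ↑ˡ n)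
  right : (b : Fin n) → Split m n (m ↑ʳ b)

split : ∀ m n (c : Fin (m + n)) → Split m n c
split ℕ.zero    n c           = right c
split (ℕ.suc m) n Fin.zero    = left Fin.zero
split (ℕ.suc m) n (Fin.suc c) with split m n c
... | left a  = left (Fin.suc a)
... | right b = right b

↑ˡ≢↑ʳ : (a : Fin m) (b : Fin n) → a ↑ˡ n ≢ m ↑ʳ b
↑ˡ≢↑ʳ {m} {n} a b eq
  with ≡.trans (sym (splitAt-↑ˡ m a n)) (≡.trans (cong (splitAt m) eq) (splitAt-↑ʳ m n b))
... | ()

_⊕_ : (Fin m → Fin p) → (Fin n → Fin q) → Fin (m + n) → Fin (p + q)
_⊕_ {m} {p} {q = q} φ ψ c = join p q (⊎-map φ ψ (splitAt m c))

⊕-↑ˡ : (φ : Fin m → Fin p) (ψ : Fin n → Fin q) (a : Fin m) → (φ ⊕ ψ) (a ↑ˡ n) ≡ φ a ↑ˡ q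
⊕-↑ˡ {m} {n = n} φ ψ a rewrite splitAt-↑ˡ m a n = refl

⊕-↑ʳ : (φ : Fin m → Fin p) (ψ : Fin n → Fin q) (b : Fin n) → (φ ⊕ ψ) (m ↑ʳ b) ≡ p ↑ʳ ψ b
⊕-↑ʳ {m} {n = n} φ ψ b rewrite splitAt-↑ʳ m n b = refl

⊕-injective : {φ : Fin m → Fin p} {ψ : Fin n → Fin q} →
              Injective _≡_ _≡_ φ → Injective _≡_ _≡_ ψ → Injective _≡_ _≡_ (φ ⊕ ψ)
⊕-injective {m} {p} {n} {q} {φ} {ψ} φ-inj ψ-inj {x} {y} eq with split m n x | split m n y
... | left a  | left a′  =
  cong (_↑ˡ n) (φ-inj (↑ˡ-injective q _ _ (≡.trans (sym (⊕-↑ˡ φ ψ a)) (≡.trans eq (⊕-↑ˡ φ ψ a′)))))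
... | left a  | right b′ = ⊥-elim (↑ˡ≢↑ʳ _ _ (≡.trans (sym (⊕-↑ˡ φ ψ a)) (≡.trans eq (⊕-↑ʳ φ ψ b′))))
... | right b | left a′  = ⊥-elim (↑ˡ≢↑ʳ _ _ (≡.trans (sym (⊕-↑ˡ φ ψ a′)) (≡.trans (sym eq) (⊕-↑ʳ φ ψ b))))
... | right b | right b′ =
  cong (m ↑ʳ_) (ψ-inj (↑ʳ-injective p _ _ (≡.trans (sym (⊕-↑ʳ φ ψ b)) (≡.trans eq (⊕-↑ʳ φ ψ b′)))))

⊕-id↣ : ∀ k → Fin n ↣ Fin m → Fin (n + k) ↣ Fin (m + k)
⊕-id↣ k i = mk↣ (⊕-injective {φ = Injection.to i} {ψ = id} (Injection.injective i) id)

-- The maps n + k → n + k' of the slice n/Inj.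
IsUnder : ∀ n → (Fin (n + k) → Fin (n + k')) → Set
IsUnder {k} {k'} n φ = ∀ a → φ (a ↑ˡ k) ≡ a ↑ˡ k'

id⊕-isUnder : (ψ : Fin k → Fin k') → IsUnder n (id ⊕ ψ)
id⊕-isUnder ψ = ⊕-↑ˡ id ψ

non-↑ˡ⇒↑ʳ : (c : Fin (n + k)) → (∀ a → c ≢ a ↑ˡ k) → Σ (Fin k) λ b → c ≡ n ↑ʳ b
non-↑ˡ⇒↑ʳ {n} {k} c c≢↑ˡ with split n k c
... | left a  = ⊥-elim (c≢↑ˡ a refl)
... | right b = b , refl

module UnderInjection (h : Fin (n + k) ↣ Fin (n + k')) (h-under : IsUnder n (Injection.to h)) where

  open Injection h using (to; injective)

  private
    to-↑ʳ : (b : Fin k) → Σ (Fin k') λ b′ → to (n ↑ʳ b) ≡ n ↑ʳ b′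
    to-↑ʳ b = non-↑ˡ⇒↑ʳ (to (n ↑ʳ b)) λ a eq → ↑ˡ≢↑ʳ a b (sym (injective (≡.trans eq (sym (h-under a)))))

  restrict : Fin k → Fin k'
  restrict b = proj₁ (to-↑ʳ b)

  restrict-injective : Injective _≡_ _≡_ restrict
  restrict-injective {b} {b′} eq = ↑ʳ-injective n b b′ (injective
    (≡.trans (proj₂ (to-↑ʳ b)) (≡.trans (cong (n ↑ʳ_) eq) (sym (proj₂ (to-↑ʳ b′))))))

  to≗id⊕restrict : to ≗ id ⊕ restrict
  to≗id⊕restrict c with split n k c
  ... | left a  = ≡.trans (h-under a) (sym (⊕-↑ˡ id restrict a))
  ... | right b = ≡.trans (proj₂ (to-↑ʳ b)) (sym (⊕-↑ʳ id restrict b))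

-- Every comparison map between finite ordinals used below (casts, weakenings,
-- their sums and composites) preserves toℕ, and any two such maps coincide.
ToℕPreserving : (Fin m → Fin n) → Set
ToℕPreserving φ = ∀ a → toℕ (φ a) ≡ toℕ a

toℕ-preserving-unique : {φ ψ : Fin m → Fin n} → ToℕPreserving φ → ToℕPreserving ψ → φ ≗ ψ
toℕ-preserving-unique φ-pres ψ-pres a = toℕ-injective (≡.trans (φ-pres a) (sym (ψ-pres a)))

toℕ-preserving⇒injective : {φ : Fin m → Fin n} → ToℕPreserving φ → Injective _≡_ _≡_ φ
toℕ-preserving⇒injective φ-pres {x} {y} eq =
  toℕ-injective (≡.trans (sym (φ-pres x)) (≡.trans (cong toℕ eq) (φ-pres y)))

toℕ-preserving⇒isUnder : {φ : Fin (n + k) → Fin (n + k')} → ToℕPreserving φ → IsUnder n φ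
toℕ-preserving⇒isUnder {k = k} {k'} φ-pres a =
  toℕ-injective (≡.trans (φ-pres _) (≡.trans (toℕ-↑ˡ a k) (sym (toℕ-↑ˡ a k'))))

id-toℕ-preserving : ToℕPreserving {m} id
id-toℕ-preserving a = refl

↑ˡ-toℕ-preserving : ∀ k → ToℕPreserving {m} (_↑ˡ k)
↑ˡ-toℕ-preserving k a = toℕ-↑ˡ a k

cast-toℕ-preserving : (eq : m ≡ n) → ToℕPreserving (cast eq)
cast-toℕ-preserving eq = toℕ-cast eq

∘-toℕ-preserving : {φ : Fin n → Fin p} {ψ : Fin m → Fin n} →
                   ToℕPreserving φ → ToℕPreserving ψ → ToℕPreserving (φ ∘ ψ)
∘-toℕ-preserving {ψ = ψ} φ-pres ψ-pres a = ≡.trans (φ-pres (ψ a)) (ψ-pres a)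

⊕id-toℕ-preserving : {φ : Fin n → Fin m} → n ≡ m → ToℕPreserving φ → ToℕPreserving (_⊕_ {q = k} φ id)
⊕id-toℕ-preserving {n} {m} {k} {φ} refl φ-pres c with split n k c
... | left a  = ≡.trans (cong toℕ (⊕-↑ˡ φ id a)) (≡.trans (toℕ-↑ˡ (φ a) k) (≡.trans (φ-pres a) (sym (toℕ-↑ˡ a k))))
... | right b = ≡.trans (cong toℕ (⊕-↑ʳ φ id b)) (≡.trans (toℕ-↑ʳ n b) (sym (toℕ-↑ʳ n b)))

reassoc : ∀ n k l → Fin (n + k + l) → Fin (n + (k + l))
reassoc n k l = cast (+-assoc n k l)

reassoc⁻¹ : ∀ n k l → Fin (n + (k + l)) → Fin (n + k + l)
reassoc⁻¹ n k l = cast (sym (+-assoc n k l))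

reassoc⁻¹-reassoc : ∀ n k l (c : Fin (n + k + l)) → reassoc⁻¹ n k l (reassoc n k l c) ≡ c
reassoc⁻¹-reassoc n k l = cast-involutive (sym (+-assoc n k l)) (+-assoc n k l)

reassoc-toℕ-preserving : ∀ n k l → ToℕPreserving (reassoc n k l)
reassoc-toℕ-preserving n k l = cast-toℕ-preserving (+-assoc n k l)

reassoc⁻¹-toℕ-preserving : ∀ n k l → ToℕPreserving (reassoc⁻¹ n k l)
reassoc⁻¹-toℕ-preserving n k l = cast-toℕ-preserving (sym (+-assoc n k l))

reassoc-↑ˡ-↑ˡ : ∀ n k l (a : Fin n) → reassoc n k l ((a ↑ˡ k) ↑ˡ l) ≡ a ↑ˡ (k + l)
reassoc-↑ˡ-↑ˡ n k l = toℕ-preserving-unique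
  (∘-toℕ-preserving (reassoc-toℕ-preserving n k l) (∘-toℕ-preserving (↑ˡ-toℕ-preserving l) (↑ˡ-toℕ-preserving k)))
  (↑ˡ-toℕ-preserving (k + l))

reassoc⁻¹-↑ˡ : ∀ n k l (a : Fin n) → reassoc⁻¹ n k l (a ↑ˡ (k + l)) ≡ (a ↑ˡ k) ↑ˡ l
reassoc⁻¹-↑ˡ n k l = toℕ-preserving-unique
  (∘-toℕ-preserving (reassoc⁻¹-toℕ-preserving n k l) (↑ˡ-toℕ-preserving (k + l)))
  (∘-toℕ-preserving (↑ˡ-toℕ-preserving l) (↑ˡ-toℕ-preserving k))

reassoc-↑ʳ-↑ˡ : ∀ n k l (b : Fin k) → reassoc n k l ((n ↑ʳ b) ↑ˡ l) ≡ n ↑ʳ (b ↑ˡ l)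
reassoc-↑ʳ-↑ˡ n k l b = toℕ-injective (begin
  toℕ (reassoc n k l ((n ↑ʳ b) ↑ˡ l)) ≡⟨ reassoc-toℕ-preserving n k l _ ⟩
  toℕ ((n ↑ʳ b) ↑ˡ l)                 ≡⟨ toℕ-↑ˡ (n ↑ʳ b) l ⟩
  toℕ (n ↑ʳ b)                        ≡⟨ toℕ-↑ʳ n b ⟩
  n + toℕ b                           ≡⟨ cong (n +_) (toℕ-↑ˡ b l) ⟨
  n + toℕ (b ↑ˡ l)                    ≡⟨ toℕ-↑ʳ n (b ↑ˡ l) ⟨
  toℕ (n ↑ʳ (b ↑ˡ l))                 ∎)
  where open ≡-Reasoning

reassoc-↑ʳ : ∀ n k l (d : Fin l) → reassoc n k l ((n + k) ↑ʳ d) ≡ n ↑ʳ (k ↑ʳ d)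
reassoc-↑ʳ n k l d = toℕ-injective (begin
  toℕ (reassoc n k l ((n + k) ↑ʳ d)) ≡⟨ reassoc-toℕ-preserving n k l _ ⟩
  toℕ ((n + k) ↑ʳ d)                 ≡⟨ toℕ-↑ʳ (n + k) d ⟩
  n + k + toℕ d                      ≡⟨ +-assoc n k (toℕ d) ⟩
  n + (k + toℕ d)                    ≡⟨ cong (n +_) (toℕ-↑ʳ k d) ⟨
  n + toℕ (k ↑ʳ d)                   ≡⟨ toℕ-↑ʳ n (k ↑ʳ d) ⟨
  toℕ (n ↑ʳ (k ↑ʳ d))                ∎)
  where open ≡-Reasoning

lookup-ext : {A : Set} {u v : Vec A n} → (∀ i → lookup u i ≡ lookup v i) → u ≡ v
lookup-ext {u = u} {v} eq = ≡.trans (sym (tabulate∘lookup u)) (≡.trans (tabulate-cong eq) (tabulate∘lookup v))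

module Monad∫ (Sg : Signature) where

  private variable
    H K : Psh Sg

  infixr 9 _⊙_
  infixl 8 _[_]

  _⊙_ : Hom Sg m p → Hom Sg n m → Hom Sg n p
  _⊙_ = _∘L_ Sg

  _[_] : Term Sg m → Hom Sg n m → Term Sg n
  t [ σ ] = sub Sg t σ

  Jf : (Fin n → Fin m) → Hom Sg m n
  Jf = Jfun Sg

  _⊞_ : Hom Sg n m → ∀ k → Hom Sg (n + k) (m + k)
  _⊞_ = _+L_ Sg

  -- Substitution and renaming

  lookup-⊙ : (σ : Hom Sg m p) (τ : Hom Sg n m) (i : Fin p) → lookup (σ ⊙ τ) i ≡ lookup σ i [ τ ]
  lookup-⊙ (t ∷ σ) τ Fin.zero    = refl
  lookup-⊙ (t ∷ σ) τ (Fin.suc i) = lookup-⊙ σ τ i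

  mutual
    sub-⊙ : (t : Term Sg p) (σ : Hom Sg m p) (τ : Hom Sg n m) → t [ σ ] [ τ ] ≡ t [ σ ⊙ τ ]
    sub-⊙ (var i)   σ τ = sym (lookup-⊙ σ τ i)
    sub-⊙ (op o ts) σ τ = cong (op o) (subs-⊙ ts σ τ)

    subs-⊙ : (ts : Vec (Term Sg p) q) (σ : Hom Sg m p) (τ : Hom Sg n m) →
             subs Sg (subs Sg ts σ) τ ≡ subs Sg ts (σ ⊙ τ)
    subs-⊙ []       σ τ = refl
    subs-⊙ (t ∷ ts) σ τ = cong₂ _∷_ (sub-⊙ t σ τ) (subs-⊙ ts σ τ)

  lookup-Jf : (φ : Fin n → Fin m) (a : Fin n) → lookup (Jf φ) a ≡ var (φ a)
  lookup-Jf φ = lookup∘tabulate (var ∘ φ)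

  Jf-cong : {φ ψ : Fin n → Fin m} → φ ≗ ψ → Jf φ ≡ Jf ψ
  Jf-cong φ≗ψ = tabulate-cong (cong var ∘ φ≗ψ)

  Jf-toℕ-preserving : {φ ψ : Fin n → Fin m} → ToℕPreserving φ → ToℕPreserving ψ → Jf φ ≡ Jf ψ
  Jf-toℕ-preserving φ-pres ψ-pres = Jf-cong (toℕ-preserving-unique φ-pres ψ-pres)

  lookup-Jf-⊙ : (φ : Fin n → Fin m) (σ : Hom Sg p m) (a : Fin n) → lookup (Jf φ ⊙ σ) a ≡ lookup σ (φ a)
  lookup-Jf-⊙ φ σ a = ≡.trans (lookup-⊙ (Jf φ) σ a) (cong (_[ σ ]) (lookup-Jf φ a))

  Jf-⊙ : (φ : Fin n → Fin m) (ψ : Fin m → Fin p) → Jf φ ⊙ Jf ψ ≡ Jf (ψ ∘ φ)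
  Jf-⊙ φ ψ = lookup-ext λ a →
    ≡.trans (lookup-Jf-⊙ φ (Jf ψ) a) (≡.trans (lookup-Jf ψ (φ a)) (sym (lookup-Jf (ψ ∘ φ) a)))

  sub-Jf-Jf : (t : Term Sg n) (φ : Fin n → Fin m) (ψ : Fin m → Fin p) → t [ Jf φ ] [ Jf ψ ] ≡ t [ Jf (ψ ∘ φ) ]
  sub-Jf-Jf t φ ψ = ≡.trans (sub-⊙ t (Jf φ) (Jf ψ)) (cong (t [_]) (Jf-⊙ φ ψ))

  -- Adding k fresh variables

  lookup-⊞-↑ˡ : (f : Hom Sg n m) (k : ℕ) (a : Fin m) → lookup (f ⊞ k) (a ↑ˡ k) ≡ lookup f a [ Jf (_↑ˡ k) ]
  lookup-⊞-↑ˡ f k a = ≡.trans (lookup-++ˡ (f ⊙ Jf (_↑ˡ k)) _ a) (lookup-⊙ f _ a)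

  lookup-⊞-↑ʳ : (f : Hom Sg n m) (k : ℕ) (b : Fin k) → lookup (f ⊞ k) (m ↑ʳ b) ≡ var (n ↑ʳ b)
  lookup-⊞-↑ʳ {n} f k b =
    ≡.trans (lookup-++ʳ (f ⊙ Jf (_↑ˡ k)) _ b) (lookup∘tabulate (λ a → var (n ↑ʳ a)) b)

  lookup-⊞-↑ˡ-Jf : (f : Hom Sg n m) (k : ℕ) (a : Fin m) (φ : Fin (n + k) → Fin p) →
                   lookup (f ⊞ k) (a ↑ˡ k) [ Jf φ ] ≡ lookup f a [ Jf (φ ∘ (_↑ˡ k)) ]
  lookup-⊞-↑ˡ-Jf f k a φ = ≡.trans (cong (_[ Jf φ ]) (lookup-⊞-↑ˡ f k a)) (sub-Jf-Jf (lookup f a) _ φ)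

  lookup-⊞-↑ʳ-Jf : (f : Hom Sg n m) (k : ℕ) (b : Fin k) (φ : Fin (n + k) → Fin p) →
                   lookup (f ⊞ k) (m ↑ʳ b) [ Jf φ ] ≡ var (φ (n ↑ʳ b))
  lookup-⊞-↑ʳ-Jf {n} f k b φ = ≡.trans (cong (_[ Jf φ ]) (lookup-⊞-↑ʳ f k b)) (lookup-Jf φ (n ↑ʳ b))

  ⊞-lookup-ext : {σ τ : Hom Sg n (m + k)} →
                 (∀ a → lookup σ (a ↑ˡ k) ≡ lookup τ (a ↑ˡ k)) → (∀ b → lookup σ (m ↑ʳ b) ≡ lookup τ (m ↑ʳ b)) → σ ≡ τ
  ⊞-lookup-ext {m = m} {k} {σ} {τ} eqˡ eqʳ = lookup-ext λ c → by-split c (split m k c)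
    where
    by-split : ∀ c → Split m k c → lookup σ c ≡ lookup τ c
    by-split _ (left a)  = eqˡ a
    by-split _ (right b) = eqʳ b

  Jf-⊞ : (φ : Fin n → Fin m) (k : ℕ) → Jf φ ⊞ k ≡ Jf (φ ⊕ id)
  Jf-⊞ {n} {m} φ k = ⊞-lookup-ext
    (λ a → begin
      lookup (Jf φ ⊞ k) (a ↑ˡ k)       ≡⟨ lookup-⊞-↑ˡ (Jf φ) k a ⟩
      lookup (Jf φ) a [ Jf (_↑ˡ k) ]   ≡⟨ lookup-⊙ (Jf φ) _ a ⟨
      lookup (Jf φ ⊙ Jf (_↑ˡ k)) a     ≡⟨ lookup-Jf-⊙ φ _ a ⟩
      lookup (Jf (_↑ˡ k)) (φ a)        ≡⟨ lookup-Jf _ (φ a) ⟩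
      var (φ a ↑ˡ k)                   ≡⟨ cong var (⊕-↑ˡ φ id a) ⟨
      var ((φ ⊕ id) (a ↑ˡ k))          ≡⟨ lookup-Jf (φ ⊕ id) (a ↑ˡ k) ⟨
      lookup (Jf (φ ⊕ id)) (a ↑ˡ k)    ∎)
    (λ b → begin
      lookup (Jf φ ⊞ k) (n ↑ʳ b)       ≡⟨ lookup-⊞-↑ʳ (Jf φ) k b ⟩
      var (m ↑ʳ b)                     ≡⟨ cong var (⊕-↑ʳ φ id b) ⟨
      var ((φ ⊕ id) (n ↑ʳ b))          ≡⟨ lookup-Jf (φ ⊕ id) (n ↑ʳ b) ⟨
      lookup (Jf (φ ⊕ id)) (n ↑ʳ b)    ∎)
    where open ≡-Reasoning

  ⊞-idL : ∀ n k → idL Sg n ⊞ k ≡ idL Sg (n + k)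
  ⊞-idL n k = ≡.trans (Jf-⊞ id k)
    (Jf-toℕ-preserving (⊕id-toℕ-preserving {n = n} {k = k} refl id-toℕ-preserving) id-toℕ-preserving)

  ↑ˡ-natural : (f : Hom Sg n m) (k : ℕ) → Jf (_↑ˡ k) ⊙ (f ⊞ k) ≡ f ⊙ Jf (_↑ˡ k)
  ↑ˡ-natural f k = lookup-ext λ a →
    ≡.trans (lookup-Jf-⊙ (_↑ˡ k) (f ⊞ k) a) (≡.trans (lookup-⊞-↑ˡ f k a) (sym (lookup-⊙ f _ a)))

  ⊞-⊙ : (g : Hom Sg m p) (f : Hom Sg n m) (k : ℕ) → (g ⊙ f) ⊞ k ≡ (g ⊞ k) ⊙ (f ⊞ k)
  ⊞-⊙ {m} {p} {n} g f k = ⊞-lookup-ext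
    (λ a → begin
      lookup ((g ⊙ f) ⊞ k) (a ↑ˡ k)          ≡⟨ lookup-⊞-↑ˡ (g ⊙ f) k a ⟩
      lookup (g ⊙ f) a [ Jf (_↑ˡ k) ]        ≡⟨ cong (_[ Jf (_↑ˡ k) ]) (lookup-⊙ g f a) ⟩
      lookup g a [ f ] [ Jf (_↑ˡ k) ]        ≡⟨ sub-⊙ (lookup g a) f _ ⟩
      lookup g a [ f ⊙ Jf (_↑ˡ k) ]          ≡⟨ cong (lookup g a [_]) (↑ˡ-natural f k) ⟨
      lookup g a [ Jf (_↑ˡ k) ⊙ (f ⊞ k) ]    ≡⟨ sub-⊙ (lookup g a) _ (f ⊞ k) ⟨
      lookup g a [ Jf (_↑ˡ k) ] [ f ⊞ k ]    ≡⟨ cong (_[ f ⊞ k ]) (lookup-⊞-↑ˡ g k a) ⟨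
      lookup (g ⊞ k) (a ↑ˡ k) [ f ⊞ k ]      ≡⟨ lookup-⊙ (g ⊞ k) (f ⊞ k) (a ↑ˡ k) ⟨
      lookup ((g ⊞ k) ⊙ (f ⊞ k)) (a ↑ˡ k)    ∎)
    (λ b → begin
      lookup ((g ⊙ f) ⊞ k) (p ↑ʳ b)          ≡⟨ lookup-⊞-↑ʳ (g ⊙ f) k b ⟩
      var (n ↑ʳ b)                           ≡⟨ lookup-⊞-↑ʳ f k b ⟨
      lookup (f ⊞ k) (m ↑ʳ b)                ≡⟨ cong (_[ f ⊞ k ]) (lookup-⊞-↑ʳ g k b) ⟨
      lookup (g ⊞ k) (p ↑ʳ b) [ f ⊞ k ]      ≡⟨ lookup-⊙ (g ⊞ k) (f ⊞ k) (p ↑ʳ b) ⟨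
      lookup ((g ⊞ k) ⊙ (f ⊞ k)) (p ↑ʳ b)    ∎)
    where open ≡-Reasoning

  ⊞-natural : (f : Hom Sg n m) (ψ : Fin k → Fin k') → Jf (id ⊕ ψ) ⊙ (f ⊞ k') ≡ (f ⊞ k) ⊙ Jf (id ⊕ ψ)
  ⊞-natural {n} {m} {k} {k'} f ψ = ⊞-lookup-ext
    (λ a → begin
      lookup (Jf (id ⊕ ψ) ⊙ (f ⊞ k')) (a ↑ˡ k)   ≡⟨ lookup-Jf-⊙ (id ⊕ ψ) (f ⊞ k') (a ↑ˡ k) ⟩
      lookup (f ⊞ k') ((id ⊕ ψ) (a ↑ˡ k))       ≡⟨ cong (lookup (f ⊞ k')) (⊕-↑ˡ id ψ a) ⟩
      lookup (f ⊞ k') (a ↑ˡ k')                 ≡⟨ lookup-⊞-↑ˡ f k' a ⟩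
      lookup f a [ Jf (_↑ˡ k') ]                ≡⟨ cong (lookup f a [_]) (Jf-cong (sym ∘ ⊕-↑ˡ id ψ)) ⟩
      lookup f a [ Jf ((id ⊕ ψ) ∘ (_↑ˡ k)) ]    ≡⟨ lookup-⊞-↑ˡ-Jf f k a (id ⊕ ψ) ⟨
      lookup (f ⊞ k) (a ↑ˡ k) [ Jf (id ⊕ ψ) ]   ≡⟨ lookup-⊙ (f ⊞ k) _ (a ↑ˡ k) ⟨
      lookup ((f ⊞ k) ⊙ Jf (id ⊕ ψ)) (a ↑ˡ k)   ∎)
    (λ b → begin
      lookup (Jf (id ⊕ ψ) ⊙ (f ⊞ k')) (m ↑ʳ b)   ≡⟨ lookup-Jf-⊙ (id ⊕ ψ) (f ⊞ k') (m ↑ʳ b) ⟩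
      lookup (f ⊞ k') ((id ⊕ ψ) (m ↑ʳ b))       ≡⟨ cong (lookup (f ⊞ k')) (⊕-↑ʳ id ψ b) ⟩
      lookup (f ⊞ k') (m ↑ʳ ψ b)                ≡⟨ lookup-⊞-↑ʳ f k' (ψ b) ⟩
      var (n ↑ʳ ψ b)                            ≡⟨ cong var (⊕-↑ʳ id ψ b) ⟨
      var ((id ⊕ ψ) (n ↑ʳ b))                   ≡⟨ lookup-⊞-↑ʳ-Jf f k b (id ⊕ ψ) ⟨
      lookup (f ⊞ k) (m ↑ʳ b) [ Jf (id ⊕ ψ) ]   ≡⟨ lookup-⊙ (f ⊞ k) _ (m ↑ʳ b) ⟨
      lookup ((f ⊞ k) ⊙ Jf (id ⊕ ψ)) (m ↑ʳ b)   ∎)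
    where open ≡-Reasoning

  ⊞-assoc : (f : Hom Sg n m) (k l : ℕ) →
            Jf (reassoc m k l) ⊙ (f ⊞ (k + l)) ≡ ((f ⊞ k) ⊞ l) ⊙ Jf (reassoc n k l)
  ⊞-assoc {n} {m} f k l = ⊞-lookup-ext
    (λ c → ≡.trans (lookup-Jf-⊙ (reassoc m k l) (f ⊞ (k + l)) (c ↑ˡ l))
             (≡.trans (lookup-↑ˡ c (split m k c)) (sym (lookup-⊙ ((f ⊞ k) ⊞ l) _ (c ↑ˡ l)))))
    (λ d → ≡.trans (lookup-Jf-⊙ (reassoc m k l) (f ⊞ (k + l)) ((m + k) ↑ʳ d))
             (≡.trans (lookup-↑ʳ d) (sym (lookup-⊙ ((f ⊞ k) ⊞ l) _ ((m + k) ↑ʳ d)))))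
    where
    open ≡-Reasoning
    J3 : Hom Sg (n + (k + l)) (n + k + l)
    J3 = Jf (reassoc n k l)

    lookup-↑ˡ : ∀ c → Split m k c →
                lookup (f ⊞ (k + l)) (reassoc m k l (c ↑ˡ l)) ≡ lookup ((f ⊞ k) ⊞ l) (c ↑ˡ l) [ J3 ]
    lookup-↑ˡ _ (left a) = begin
      lookup (f ⊞ (k + l)) (reassoc m k l ((a ↑ˡ k) ↑ˡ l))  ≡⟨ cong (lookup (f ⊞ (k + l))) (reassoc-↑ˡ-↑ˡ m k l a) ⟩
      lookup (f ⊞ (k + l)) (a ↑ˡ (k + l))                  ≡⟨ lookup-⊞-↑ˡ f (k + l) a ⟩
      lookup f a [ Jf (_↑ˡ (k + l)) ]                      ≡⟨ cong (lookup f a [_]) (Jf-cong (sym ∘ reassoc-↑ˡ-↑ˡ n k l)) ⟩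
      lookup f a [ Jf (reassoc n k l ∘ (_↑ˡ l) ∘ (_↑ˡ k)) ] ≡⟨ lookup-⊞-↑ˡ-Jf f k a (reassoc n k l ∘ (_↑ˡ l)) ⟨
      lookup (f ⊞ k) (a ↑ˡ k) [ Jf (reassoc n k l ∘ (_↑ˡ l)) ] ≡⟨ lookup-⊞-↑ˡ-Jf (f ⊞ k) l (a ↑ˡ k) (reassoc n k l) ⟨
      lookup ((f ⊞ k) ⊞ l) ((a ↑ˡ k) ↑ˡ l) [ J3 ]          ∎
    lookup-↑ˡ _ (right b) = begin
      lookup (f ⊞ (k + l)) (reassoc m k l ((m ↑ʳ b) ↑ˡ l))  ≡⟨ cong (lookup (f ⊞ (k + l))) (reassoc-↑ʳ-↑ˡ m k l b) ⟩
      lookup (f ⊞ (k + l)) (m ↑ʳ (b ↑ˡ l))                 ≡⟨ lookup-⊞-↑ʳ f (k + l) (b ↑ˡ l) ⟩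
      var (n ↑ʳ (b ↑ˡ l))                                  ≡⟨ cong var (reassoc-↑ʳ-↑ˡ n k l b) ⟨
      var (reassoc n k l ((n ↑ʳ b) ↑ˡ l))                  ≡⟨ lookup-⊞-↑ʳ-Jf f k b (reassoc n k l ∘ (_↑ˡ l)) ⟨
      lookup (f ⊞ k) (m ↑ʳ b) [ Jf (reassoc n k l ∘ (_↑ˡ l)) ] ≡⟨ lookup-⊞-↑ˡ-Jf (f ⊞ k) l (m ↑ʳ b) (reassoc n k l) ⟨
      lookup ((f ⊞ k) ⊞ l) ((m ↑ʳ b) ↑ˡ l) [ J3 ]          ∎

    lookup-↑ʳ : ∀ d → lookup (f ⊞ (k + l)) (reassoc m k l ((m + k) ↑ʳ d)) ≡ lookup ((f ⊞ k) ⊞ l) ((m + k) ↑ʳ d) [ J3 ]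
    lookup-↑ʳ d = begin
      lookup (f ⊞ (k + l)) (reassoc m k l ((m + k) ↑ʳ d))  ≡⟨ cong (lookup (f ⊞ (k + l))) (reassoc-↑ʳ m k l d) ⟩
      lookup (f ⊞ (k + l)) (m ↑ʳ (k ↑ʳ d))                 ≡⟨ lookup-⊞-↑ʳ f (k + l) (k ↑ʳ d) ⟩
      var (n ↑ʳ (k ↑ʳ d))                                  ≡⟨ cong var (reassoc-↑ʳ n k l d) ⟨
      var (reassoc n k l ((n + k) ↑ʳ d))                   ≡⟨ lookup-⊞-↑ʳ-Jf (f ⊞ k) l d (reassoc n k l) ⟨
      lookup ((f ⊞ k) ⊞ l) ((m + k) ↑ʳ d) [ J3 ]           ∎

  module Presheaf {H : Psh Sg} (H-psh : IsPsh Sg H) where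

    open IsPsh H-psh public

    infix 4 _≈_
    _≈_ : Car Sg H n → Car Sg H n → Set
    _≈_ = _⊢_≈_ Sg H

    ≈-refl : {x : Car Sg H n} → x ≈ x
    ≈-refl = Poset.Eq.refl (obj H _)

    ≈-sym : {x y : Car Sg H n} → x ≈ y → y ≈ x
    ≈-sym = Poset.Eq.sym (obj H _)

    ≈-trans : {x y z : Car Sg H n} → x ≈ y → y ≈ z → x ≈ z
    ≈-trans = Poset.Eq.trans (obj H _)

    ≈⇒≤ : {x y : Car Sg H n} → x ≈ y → _⊢_≤_ Sg H x y
    ≈⇒≤ = Poset.reflexive (obj H _)

    ≡⇒act≈ : {σ τ : Hom Sg n m} {x : Car Sg H m} → σ ≡ τ → act H σ x ≈ act H τ x
    ≡⇒act≈ refl = ≈-refl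

    act-cong : (σ : Hom Sg n m) {x y : Car Sg H m} → x ≈ y → act H σ x ≈ act H σ y
    act-cong σ x≈y = Poset.antisym (obj H _) (act-mono σ (≈⇒≤ x≈y)) (act-mono σ (≈⇒≤ (≈-sym x≈y)))

    act-square : {f : Hom Sg n m} {g : Hom Sg m p} {f′ : Hom Sg n q} {g′ : Hom Sg q p} {x : Car Sg H p} →
                 g ⊙ f ≡ g′ ⊙ f′ → act H f (act H g x) ≈ act H f′ (act H g′ x)
    act-square {f = f} {g} {f′} {g′} {x} eq =
      ≈-trans (≈-sym (act-∘ f g x)) (≈-trans (≡⇒act≈ eq) (act-∘ f′ g′ x))

    act-Jf-Jf : (φ : Fin n → Fin m) (ψ : Fin m → Fin p) (x : Car Sg H n) →
                act H (Jf ψ) (act H (Jf φ) x) ≈ act H (Jf (ψ ∘ φ)) x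
    act-Jf-Jf φ ψ x = ≈-trans (≈-sym (act-∘ (Jf ψ) (Jf φ) x)) (≡⇒act≈ (Jf-⊙ φ ψ))

    ∫≈-base : {x y : Car Sg H (n + k)} → x ≈ y → ∫≈ Sg H n (k , x) (k , y)
    ∫≈-base x≈y = base (≈⇒≤ x≈y) , base (≈⇒≤ (≈-sym x≈y))

    ∫≈-glue : {φ : Fin (n + k) → Fin (n + k')} → Injective _≡_ _≡_ φ → IsUnder n φ →
              {x : Car Sg H (n + k)} {y : Car Sg H (n + k')} → y ≈ act H (Jf φ) x → ∫≈ Sg H n (k , x) (k' , y)
    ∫≈-glue φ-inj φ-under {x} y≈ = trans (glue (mk↣ φ-inj) φ-under x) (base (≈⇒≤ (≈-sym y≈))) ,
                                   trans (base (≈⇒≤ y≈)) (glue⁻ (mk↣ φ-inj) φ-under x)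

    ∫≈-reindex : {φ : Fin (n + k) → Fin (n + k')} → ToℕPreserving φ →
                 {x : Car Sg H (n + k)} {y : Car Sg H (n + k')} → y ≈ act H (Jf φ) x → ∫≈ Sg H n (k , x) (k' , y)
    ∫≈-reindex φ-pres = ∫≈-glue (toℕ-preserving⇒injective φ-pres) (toℕ-preserving⇒isUnder φ-pres)

  -- ∫ is an endofunctor

  ∫-isPsh : IsPsh Sg H → IsPsh Sg (∫ Sg H)
  ∫-isPsh {H} H-psh = record { act-mono = act-mono∫ ; act-id = act-id∫ ; act-∘ = act-∘∫ }
    where
    open Presheaf H-psh

    act-glue : (f : Hom Sg n m) (h : Fin (m + k) ↣ Fin (m + k')) (h-under : Under Sg m k k' h) (x : Car Sg H (m + k)) →
               ∫≈ Sg H n (k , act H (f ⊞ k) x) (k' , act H (f ⊞ k') (act H (J Sg h) x))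
    act-glue {k = k} {k'} f h h-under x =
      ∫≈-glue (⊕-injective id restrict-injective) (id⊕-isUnder restrict) (act-square restricted-square)
      where
      open UnderInjection h h-under
      restricted-square : J Sg h ⊙ (f ⊞ k') ≡ (f ⊞ k) ⊙ Jf (id ⊕ restrict)
      restricted-square = ≡.trans (cong (_⊙ (f ⊞ k')) (Jf-cong to≗id⊕restrict)) (⊞-natural f restrict)

    act-mono∫ : (f : Hom Sg n m) {a b : ∫Car Sg H m} → ∫≤ Sg H m a b →
                ∫≤ Sg H n (act (∫ Sg H) f a) (act (∫ Sg H) f b)
    act-mono∫ f (base x≤y)           = base (act-mono (f ⊞ _) x≤y)
    act-mono∫ f (glue h h-under x)  = proj₁ (act-glue f h h-under x)
    act-mono∫ f (glue⁻ h h-under x) = proj₂ (act-glue f h h-under x)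
    act-mono∫ f (trans a≤b b≤c)      = trans (act-mono∫ f a≤b) (act-mono∫ f b≤c)

    act-id∫ : (a : ∫Car Sg H n) → ∫≈ Sg H n (act (∫ Sg H) (idL Sg n) a) a
    act-id∫ {n} (k , x) = ∫≈-base (≈-trans (≡⇒act≈ (⊞-idL n k)) (act-id x))

    act-∘∫ : (f : Hom Sg n m) (g : Hom Sg m p) (a : ∫Car Sg H p) →
             ∫≈ Sg H n (act (∫ Sg H) (g ⊙ f) a) (act (∫ Sg H) f (act (∫ Sg H) g a))
    act-∘∫ f g (k , x) = ∫≈-base (≈-trans (≡⇒act≈ (⊞-⊙ g f k)) (act-∘ (f ⊞ k) (g ⊞ k) x))

  ∫₁-isLaxInj : (α : Trans Sg H K) → IsPsh Sg H → IsPsh Sg K →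
                IsLaxInj Sg H K α → IsLaxInj Sg (∫ Sg H) (∫ Sg K) (∫₁ Sg {H} {K} α)
  ∫₁-isLaxInj {H} {K} α H-psh K-psh α-lax = record
    { mono   = mono∫
    ; lax    = λ f → λ { (k , x) → base (lax (f ⊞ k) x) }
    ; strict = strict∫
    }
    where
    module H = Presheaf H-psh
    module K = Presheaf K-psh
    open IsLaxInj α-lax

    α-cong : {x y : Car Sg H n} → x H.≈ y → α n x K.≈ α n y
    α-cong x≈y = Poset.antisym (obj K _) (mono _ (H.≈⇒≤ x≈y)) (mono _ (H.≈⇒≤ (H.≈-sym x≈y)))

    mono∫ : ∀ n {a b} → ∫≤ Sg H n a b → ∫≤ Sg K n (∫₁ Sg {H} {K} α n a) (∫₁ Sg {H} {K} α n b)
    mono∫ n (base x≤y)           = base (mono _ x≤y)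
    mono∫ n (glue h h-under x)  = trans (glue h h-under (α _ x)) (base (K.≈⇒≤ (strict h x)))
    mono∫ n (glue⁻ h h-under x) = trans (base (K.≈⇒≤ (K.≈-sym (strict h x)))) (glue⁻ h h-under (α _ x))
    mono∫ n (trans a≤b b≤c)      = trans (mono∫ n a≤b) (mono∫ n b≤c)

    strict∫ : (i : Fin n ↣ Fin m) (a : ∫Car Sg H n) →
              ∫≈ Sg K m (act (∫ Sg K) (J Sg i) (∫₁ Sg {H} {K} α n a)) (∫₁ Sg {H} {K} α m (act (∫ Sg H) (J Sg i) a))
    strict∫ i (k , x) = K.∫≈-base (K.≈-trans (K.≡⇒act≈ (Jf-⊞ (Injection.to i) k))
      (K.≈-trans (strict (⊕-id↣ k i) x) (α-cong (H.≡⇒act≈ (sym (Jf-⊞ (Injection.to i) k))))))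

  -- Unit and multiplication

  η-isLaxInj : (H-psh : IsPsh Sg H) → IsLaxInj Sg H (∫ Sg H) (η Sg H)
  η-isLaxInj H-psh = record
    { mono   = λ _ x≤y → base (act-mono (Jf (_↑ˡ 0)) x≤y)
    ; lax    = λ f x → base (≈⇒≤ (act-square (↑ˡ-natural f 0)))
    ; strict = λ i x → ∫≈-base (act-square (↑ˡ-natural (J Sg i) 0))
    }
    where open Presheaf H-psh

  μ-isLaxInj : (H-psh : IsPsh Sg H) → IsLaxInj Sg (∫ Sg (∫ Sg H)) (∫ Sg H) (μ Sg H)
  μ-isLaxInj {H} H-psh = record
    { mono   = mono-μ
    ; lax    = λ f a → proj₁ (μ-act f a)
    ; strict = λ i → μ-act (J Sg i)
    }
    where
    open Presheaf H-psh

    μ-act : (f : Hom Sg n m) (a : ∫Car Sg (∫ Sg H) m) →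
            ∫≈ Sg H n (act (∫ Sg H) f (μ Sg H m a)) (μ Sg H n (act (∫ Sg (∫ Sg H)) f a))
    μ-act f (k , (l , x)) = ∫≈-base (act-square (⊞-assoc f k l))

    -- A gluing along ψ in the doubly indexed colimit is a gluing in ∫H(n) along ψ conjugated by reassoc.
    μ-glue : {ψ : Fin (n + k + l) → Fin (n + k' + l')} → Injective _≡_ _≡_ ψ →
             (∀ a → ψ ((a ↑ˡ k) ↑ˡ l) ≡ (a ↑ˡ k') ↑ˡ l') →
             {x : Car Sg H (n + k + l)} {y : Car Sg H (n + k' + l')} → y ≈ act H (Jf ψ) x →
             ∫≈ Sg H n (μ Sg H n (k , (l , x))) (μ Sg H n (k' , (l' , y)))
    μ-glue {n} {k} {l} {k'} {l'} {ψ} ψ-inj ψ-under y≈ =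
      ∫≈-glue φ-inj φ-under (≈-trans (act-cong _ y≈) (act-square square))
      where
      φ : Fin (n + (k + l)) → Fin (n + (k' + l'))
      φ = reassoc n k' l' ∘ ψ ∘ reassoc⁻¹ n k l

      φ-inj : Injective _≡_ _≡_ φ
      φ-inj = toℕ-preserving⇒injective (reassoc⁻¹-toℕ-preserving n k l)
            ∘ ψ-inj ∘ toℕ-preserving⇒injective (reassoc-toℕ-preserving n k' l')

      φ-under : IsUnder n φ
      φ-under a = ≡.trans (cong (reassoc n k' l' ∘ ψ) (reassoc⁻¹-↑ˡ n k l a))
                    (≡.trans (cong (reassoc n k' l') (ψ-under a)) (reassoc-↑ˡ-↑ˡ n k' l' a))

      square : Jf ψ ⊙ Jf (reassoc n k' l') ≡ Jf (reassoc n k l) ⊙ Jf φ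
      square = ≡.trans (Jf-⊙ ψ (reassoc n k' l'))
        (≡.trans (Jf-cong (λ c → cong (reassoc n k' l' ∘ ψ) (sym (reassoc⁻¹-reassoc n k l c))))
          (sym (Jf-⊙ (reassoc n k l) φ)))

    inner-glue : (h : Fin (n + k + l) ↣ Fin (n + k + l')) → Under Sg (n + k) l l' h → (x : Car Sg H (n + k + l)) →
                 ∫≈ Sg H n (μ Sg H n (k , (l , x))) (μ Sg H n (k , (l' , act H (J Sg h) x)))
    inner-glue {k = k} h h-under x = μ-glue (Injection.injective h) (h-under ∘ (_↑ˡ k)) ≈-refl

    outer-glue : (h : Fin (n + k) ↣ Fin (n + k')) → Under Sg n k k' h → (l : ℕ) (x : Car Sg H (n + k + l)) →
                 ∫≈ Sg H n (μ Sg H n (k , (l , x))) (μ Sg H n (k' , (l , act H (J Sg h ⊞ l) x)))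
    outer-glue {k = k} h h-under l x = μ-glue (Injection.injective (⊕-id↣ l h))
      (λ a → ≡.trans (⊕-↑ˡ (Injection.to h) id (a ↑ˡ k)) (cong (_↑ˡ l) (h-under a)))
      (≡⇒act≈ (Jf-⊞ (Injection.to h) l))

    mono-inner : {a b : ∫Car Sg H (n + k)} → ∫≤ Sg H (n + k) a b → ∫≤ Sg H n (μ Sg H n (k , a)) (μ Sg H n (k , b))
    mono-inner {n} {k} (base {l} x≤y)  = base (act-mono (Jf (reassoc n k l)) x≤y)
    mono-inner (glue h h-under x)   = proj₁ (inner-glue h h-under x)
    mono-inner (glue⁻ h h-under x)  = proj₂ (inner-glue h h-under x)
    mono-inner (trans a≤b b≤c)      = trans (mono-inner a≤b) (mono-inner b≤c)

    mono-μ : ∀ n {a b} → ∫≤ Sg (∫ Sg H) n a b → ∫≤ Sg H n (μ Sg H n a) (μ Sg H n b)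
    mono-μ n (base a≤b)                  = mono-inner a≤b
    mono-μ n (glue h h-under (l , x))   = proj₁ (outer-glue h h-under l x)
    mono-μ n (glue⁻ h h-under (l , x))  = proj₂ (outer-glue h h-under l x)
    mono-μ n (trans a≤b b≤c)             = trans (mono-μ n a≤b) (mono-μ n b≤c)

  η-natural : (K-psh : IsPsh Sg K) {α : Trans Sg H K} → IsLaxInj Sg H K α → (x : Car Sg H n) →
              ∫≈ Sg K n (∫₁ Sg {H} {K} α n (η Sg H n x)) (η Sg K n (α n x))
  η-natural K-psh α-lax x =
    ∫≈-base (≈-sym (IsLaxInj.strict α-lax (mk↣ (↑ˡ-injective 0 _ _)) x))
    where open Presheaf K-psh

  μ-natural : (K-psh : IsPsh Sg K) {α : Trans Sg H K} → IsLaxInj Sg H K α → (a : ∫Car Sg (∫ Sg H) n) →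
              ∫≈ Sg K n (∫₁ Sg {H} {K} α n (μ Sg H n a)) (μ Sg K n (∫₁ Sg {∫ Sg H} {∫ Sg K} (∫₁ Sg {H} {K} α) n a))
  μ-natural {n = n} K-psh α-lax (k , (l , x)) =
    ∫≈-base (≈-sym (IsLaxInj.strict α-lax (mk↣ (toℕ-preserving⇒injective (reassoc-toℕ-preserving n k l))) x))
    where open Presheaf K-psh

  -- Monad laws

  μ∘η≈id : (H-psh : IsPsh Sg H) (a : ∫Car Sg H n) → ∫≈ Sg H n (μ Sg H n (η Sg (∫ Sg H) n a)) a
  μ∘η≈id {n = n} H-psh (k , x) =
    ∫≈-base (≈-trans (≈-sym (act-∘ _ _ x)) (≈-trans (≡⇒act≈ collapse) (act-id x)))
    where
    open Presheaf H-psh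
    collapse : (Jf (ι Sg n 0) ⊞ k) ⊙ Jf (reassoc n 0 k) ≡ idL Sg (n + k)
    collapse = ≡.trans (cong (_⊙ Jf (reassoc n 0 k)) (Jf-⊞ (ι Sg n 0) k))
      (≡.trans (Jf-⊙ (ι Sg n 0 ⊕ id) (reassoc n 0 k))
        (Jf-toℕ-preserving (∘-toℕ-preserving (reassoc-toℕ-preserving n 0 k)
                                              (⊕id-toℕ-preserving {k = k} (sym (+-identityʳ n)) (↑ˡ-toℕ-preserving 0)))
                           id-toℕ-preserving))

  μ∘∫η≈id : (H-psh : IsPsh Sg H) (a : ∫Car Sg H n) → ∫≈ Sg H n (μ Sg H n (∫₁ Sg {H} {∫ Sg H} (η Sg H) n a)) a
  μ∘∫η≈id {n = n} H-psh (k , x) = swap (∫≈-reindex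
    (∘-toℕ-preserving (reassoc-toℕ-preserving n k 0) (↑ˡ-toℕ-preserving 0))
    (act-Jf-Jf (_↑ˡ 0) (reassoc n k 0) x))
    where open Presheaf H-psh

  μ∘μ≈μ∘∫μ : (H-psh : IsPsh Sg H) (a : ∫Car Sg (∫ Sg (∫ Sg H)) n) →
             ∫≈ Sg H n (μ Sg H n (μ Sg (∫ Sg H) n a)) (μ Sg H n (∫₁ Sg {∫ Sg (∫ Sg H)} {∫ Sg H} (μ Sg H) n a))
  μ∘μ≈μ∘∫μ {H} {n} H-psh (k , (l , (m , x))) = ∫≈-reindex (cast-toℕ-preserving n+[k+l+m]≡n+[k+[l+m]]) (begin
    act H (Jf c₂) (act H (Jf c₁) x)                           ≈⟨ act-Jf-Jf c₁ c₂ x ⟩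
    act H (Jf (c₂ ∘ c₁)) x                                    ≡⟨ cong (λ σ → act H σ x) reindexings-agree ⟩
    act H (Jf (φ ∘ c₃ ∘ (c₄ ⊕ id))) x                         ≈⟨ act-Jf-Jf (c₄ ⊕ id) (φ ∘ c₃) x ⟨
    act H (Jf (φ ∘ c₃)) (act H (Jf (c₄ ⊕ id)) x)              ≈⟨ act-Jf-Jf c₃ φ _ ⟨
    act H (Jf φ) (act H (Jf c₃) (act H (Jf (c₄ ⊕ id)) x))     ≈⟨ act-cong (Jf φ) (act-cong (Jf c₃) (≡⇒act≈ (Jf-⊞ c₄ m))) ⟨
    act H (Jf φ) (act H (Jf c₃) (act H (Jf c₄ ⊞ m) x))        ∎)
    where
    open Presheaf H-psh
    open SetoidReasoning (Poset.Eq.setoid (obj H (n + (k + (l + m)))))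

    n+[k+l+m]≡n+[k+[l+m]] : n + (k + l + m) ≡ n + (k + (l + m))
    n+[k+l+m]≡n+[k+[l+m]] = cong (n +_) (+-assoc k l m)

    φ : Fin (n + (k + l + m)) → Fin (n + (k + (l + m)))
    φ = cast n+[k+l+m]≡n+[k+[l+m]]

    c₁ : Fin (n + k + l + m) → Fin (n + k + (l + m))
    c₁ = reassoc (n + k) l m

    c₂ : Fin (n + k + (l + m)) → Fin (n + (k + (l + m)))
    c₂ = reassoc n k (l + m)

    c₃ : Fin (n + (k + l) + m) → Fin (n + (k + l + m))
    c₃ = reassoc n (k + l) m

    c₄ : Fin (n + k + l) → Fin (n + (k + l))
    c₄ = reassoc n k l

    reindexings-agree : Jf (c₂ ∘ c₁) ≡ Jf (φ ∘ c₃ ∘ (c₄ ⊕ id))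
    reindexings-agree = Jf-toℕ-preserving
      (∘-toℕ-preserving (reassoc-toℕ-preserving n k (l + m)) (reassoc-toℕ-preserving (n + k) l m))
      (∘-toℕ-preserving (cast-toℕ-preserving n+[k+l+m]≡n+[k+[l+m]])
        (∘-toℕ-preserving (reassoc-toℕ-preserving n (k + l) m)
          (⊕id-toℕ-preserving (+-assoc n k l) (reassoc-toℕ-preserving n k l))))

  isMonad∫ : IsMonad∫ Sg
  isMonad∫ = record
    { ∫-obj  = λ _ → ∫-isPsh
    ; ∫-map  = λ _ _ → ∫₁-isLaxInj
    ; ∫-id   = λ H _ n _ → Poset.Eq.refl (obj (∫ Sg H) n)
    ; ∫-∘    = λ _ _ M _ _ _ _ _ _ _ n _ → Poset.Eq.refl (obj (∫ Sg M) n)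
    ; η-map  = λ _ → η-isLaxInj
    ; μ-map  = λ _ → μ-isLaxInj
    ; η-nat  = λ _ _ _ _ K-psh α-lax _ → η-natural K-psh α-lax
    ; μ-nat  = λ _ _ _ _ K-psh α-lax _ → μ-natural K-psh α-lax
    ; unit-l = λ _ H-psh _ → μ∘η≈id H-psh
    ; unit-r = λ _ H-psh _ → μ∘∫η≈id H-psh
    ; assoc  = λ _ H-psh _ → μ∘μ≈μ∘∫μ H-psh
    }

proposition25 : (Sg : Signature) → IsMonad∫ Sg
proposition25 = Monad∫.isMonad∫
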